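{- Let $G$ be a connected graph of odd size. For every vertex $v\in V(G)$ there exists an edge $e$ incident with $v$ such that every connected component of $G-e$ has even size.
   Context: All graphs are finite and simple. The size of a graph is its number of edges. -}

module Defs where

open import Data.Nat using (ℕ; zero; suc; _<ᵇ_)
open import Data.Nat.Divisibility using (_∣_)
open import Data.Bool using (Bool; true; false; _∧_; not; if_then_else_)
open import Data.Fin using (Fin; toℕ; _≟_)
open import Data.List using (List; map; allFin)
open import Data.Nat.ListAction using (sum)
open import Relation.Binary.PropositionalEquality using (_≡_)
open import Relation.Nullary.Decidable using (⌊_⌋)
open import Relation.Nullary using (¬_)
open import Data.Empty using (⊥)

record Graph : Set where
  field
    n     : ℕ
    adj   : Fin n → Fin n → Bool
    sym   : ∀ x y → adj x y ≡ adj y x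
    irrefl : ∀ x → adj x x ≡ false
open Graph public

countPairs : {n : ℕ} → (Fin n → Fin n → Bool) → ℕ
countPairs {n} a =
  sum (map (λ i → sum (map (λ j → if (toℕ i <ᵇ toℕ j) ∧ a i j then 1 else 0)
                           (allFin n)))
           (allFin n))

size : Graph → ℕ
size G = countPairs (adj G)

samePair : {n : ℕ} → Fin n → Fin n → Fin n → Fin n → Bool
samePair x y u v = (⌊ x ≟ u ⌋ ∧ ⌊ y ≟ v ⌋) Data.Bool.∨ (⌊ x ≟ v ⌋ ∧ ⌊ y ≟ u ⌋)

deleteEdge : (G : Graph) → Fin (n G) → Fin (n G) → Graph
deleteEdge G u v = record
  { n = n G
  ; adj = λ x y → adj G x y ∧ not (samePair x y u v)
  ; sym = symProof
  ; irrefl = λ x → irr x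
  }
  where
  open import Relation.Binary.PropositionalEquality using (cong₂; refl)
  open import Data.Bool.Properties using (∨-comm; ∧-comm)
  open import Relation.Binary.PropositionalEquality using (trans)
  symPair : ∀ x y → samePair x y u v ≡ samePair y x u v
  symPair x y = trans (∨-comm (⌊ x ≟ u ⌋ ∧ ⌊ y ≟ v ⌋) (⌊ x ≟ v ⌋ ∧ ⌊ y ≟ u ⌋))
    (cong₂ Data.Bool._∨_ (∧-comm ⌊ x ≟ v ⌋ ⌊ y ≟ u ⌋) (∧-comm ⌊ x ≟ u ⌋ ⌊ y ≟ v ⌋))
  symProof : ∀ x y → (adj G x y ∧ not (samePair x y u v)) ≡ (adj G y x ∧ not (samePair y x u v))
  symProof x y = cong₂ (λ a b → a ∧ not b) (Graph.sym G x y) (symPair x y)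
  irr : ∀ x → (adj G x x ∧ not (samePair x x u v)) ≡ false
  irr x rewrite Graph.irrefl G x = refl

data Reach (G : Graph) : Fin (n G) → Fin (n G) → Set where
  here : ∀ {x} → Reach G x x
  step : ∀ {x y z} → adj G x y ≡ true → Reach G y z → Reach G x z

Connected : Graph → Set
Connected G = ∀ x y → Reach G x y

sizeIn : (G : Graph) → (Fin (n G) → Bool) → ℕ
sizeIn G S = countPairs (λ x y → adj G x y ∧ S x ∧ S y)

Even : ℕ → Set
Even m = 2 ∣ m

Odd : ℕ → Set
Odd m = ¬ (2 ∣ m)

AllComponentsEven : Graph → Set
AllComponentsEven G =
  ∀ (x : Fin (n G)) (S : Fin (n G) → Bool) →
    (∀ y → S y ≡ true → Reach G x y) →
    (∀ y → Reach G x y → S y ≡ true) →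
    Even (sizeIn G S)

-- If for some edge vw the component B_w of w in G − vw has even size, then, since
-- G − vw has the even size |E(G)| − 1 and every vertex still reaches v or w, its components
-- are B_w and possibly the rest, both even. Otherwise every such vw is a bridge (if not,
-- B_w is all of G − vw, which is even), so the branches B_w are pairwise disjoint and
-- cover V(G) − v. Every edge of G is then some vw or lies in exactly one branch, whence
-- |E(G)| = Σ_w (1 + |E(B_w)|) is a sum of even numbers, a contradiction.
module Submission where

open import Defs hiding (sym)
open import Data.Bool using (Bool; true; false; _∧_; _∨_; not; if_then_else_)
open import Data.Bool.Properties
  using (∧-comm; ∨-comm; ∧-zeroʳ; ∧-identityʳ; ∨-zeroʳ; ¬-not; ⇔→≡; T-≡)
  renaming (_≟_ to _≟ᵇ_)
open import Data.Fin using (Fin; zero; suc; toℕ; _≟_)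
open import Data.Fin.Properties using (any?; punchInᵢ≢i; <-cmp)
open import Data.List using (tabulate; allFin) renaming (map to mapᴸ)
open import Data.List.Properties using (map-tabulate)
import Data.Nat.ListAction as List
open import Data.Nat using (ℕ; _+_; _<_; _<ᵇ_)
open import Data.Nat.Properties
  using (+-comm; +-identityʳ; +-0-commutativeMonoid; <ᵇ⇒<; <⇒<ᵇ; <-asym; suc-injective)
open import Data.Nat.Divisibility using (_∣?_; _∣0; ∣-refl; ∣m∣n⇒∣m+n; ∣m+n∣m⇒∣n)
open import Algebra.Properties.CommutativeMonoid.Sum +-0-commutativeMonoid
  using (sum-syntax; sum-remove; ∑-distrib-+; ∑-comm; sum-cong-≗; sum-replicate-zero)
open import Data.Product using (Σ; ∃; _×_; _,_; proj₁; proj₂)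
open import Data.Sum using (_⊎_; inj₁; inj₂; [_,_]′) renaming (map to map⊎; swap to swap⊎)
open import Function using (id; _∘_; flip; mk⇔; Equivalence)
open import Relation.Binary using (tri<; tri≈; tri>)
open import Relation.Binary.PropositionalEquality
  using (_≡_; refl; sym; trans; cong; cong₂; subst; module ≡-Reasoning)
open import Relation.Nullary using (¬_; Dec; yes; no; contradiction)
open import Relation.Nullary.Decidable using (⌊_⌋; _×-dec_; map′)

⟦_⟧ : Bool → ℕ
⟦ b ⟧ = if b then 1 else 0

from⌊⌋ : ∀ {a} {A : Set a} (a? : Dec A) → ⌊ a? ⌋ ≡ true → A
from⌊⌋ (yes a) _ = a

to⌊⌋ : ∀ {a} {A : Set a} (a? : Dec A) → A → ⌊ a? ⌋ ≡ true
to⌊⌋ (yes _) _ = refl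
to⌊⌋ (no ¬a) a = contradiction a ¬a

∧-true : ∀ {a b} → a ∧ b ≡ true → a ≡ true × b ≡ true
∧-true {true} {true} _ = refl , refl

∨-true : ∀ {a b} → a ∨ b ≡ true → a ≡ true ⊎ b ≡ true
∨-true {true} _ = inj₁ refl
∨-true {false} b = inj₂ b

not-true : ∀ {b} → not b ≡ true → ¬ b ≡ true
not-true {true} ()

not-∧-equal : ∀ {b c} → b ≡ c → not (b ∧ c) ≡ not b ∧ not c
not-∧-equal {false} refl = refl
not-∧-equal {true} refl = refl

parity : ∀ m → Even m ⊎ Even (ℕ.suc m)
parity ℕ.zero = inj₁ (2 ∣0)
parity (ℕ.suc m) with parity m
... | inj₁ even = inj₂ (∣m∣n⇒∣m+n (∣-refl {2}) even)
... | inj₂ even = inj₁ even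

odd⇒even-suc : ∀ {m} → Odd m → Even (ℕ.suc m)
odd⇒even-suc {m} odd = [ flip contradiction odd , id ]′ (parity m)

odd-suc⇒even : ∀ {m} → Odd (ℕ.suc m) → Even m
odd-suc⇒even {m} odd = [ id , flip contradiction odd ]′ (parity m)

∑-tabulate : ∀ {m} (f : Fin m → ℕ) → List.sum (tabulate f) ≡ ∑[ i < m ] f i
∑-tabulate {ℕ.zero} f = refl
∑-tabulate {ℕ.suc m} f = cong (f zero +_) (∑-tabulate (f ∘ suc))

∑-allFin : ∀ {m} (f : Fin m → ℕ) → List.sum (mapᴸ f (allFin m)) ≡ ∑[ i < m ] f i
∑-allFin f = trans (cong List.sum (map-tabulate id f)) (∑-tabulate f)

∑-zero : ∀ {m} {f : Fin m → ℕ} → (∀ i → f i ≡ 0) → ∑[ i < m ] f i ≡ 0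
∑-zero {m} f≗0 = trans (sum-cong-≗ f≗0) (sum-replicate-zero m)

∑-single : ∀ {m} (f : Fin m → ℕ) (i₀ : Fin m) → (∀ i → ¬ i ≡ i₀ → f i ≡ 0) →
           ∑[ i < m ] f i ≡ f i₀
∑-single {ℕ.suc m} f i₀ f≗0 =
  trans (sum-remove {i = i₀} f)
        (trans (cong (f i₀ +_) (∑-zero λ j → f≗0 _ (punchInᵢ≢i i₀ j))) (+-identityʳ _))

∑-indicator-unique : ∀ {m} {P : Fin m → Bool} (i₀ : Fin m) → P i₀ ≡ true →
                     (∀ i → P i ≡ true → i ≡ i₀) → ∑[ i < m ] ⟦ P i ⟧ ≡ 1
∑-indicator-unique i₀ P₀ unique =
  trans (∑-single _ i₀ λ i i≢i₀ → cong ⟦_⟧ (¬-not (i≢i₀ ∘ unique i))) (cong ⟦_⟧ P₀)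

∑∑-indicator-unique : ∀ {m} {Q : Fin m → Fin m → Bool} (i₀ j₀ : Fin m) → Q i₀ j₀ ≡ true →
                      (∀ i j → Q i j ≡ true → i ≡ i₀ × j ≡ j₀) →
                      ∑[ i < m ] ∑[ j < m ] ⟦ Q i j ⟧ ≡ 1
∑∑-indicator-unique i₀ j₀ Q₀ unique =
  trans (∑-single _ i₀ λ i i≢i₀ → ∑-zero λ j → cong ⟦_⟧ (¬-not (i≢i₀ ∘ proj₁ ∘ unique i j)))
        (∑-indicator-unique j₀ Q₀ λ j → proj₂ ∘ unique i₀ j)

∑-even : ∀ {m} (f : Fin m → ℕ) → (∀ i → Even (f i)) → Even (∑[ i < m ] f i)
∑-even {ℕ.zero} f _ = 2 ∣0
∑-even {ℕ.suc m} f even = ∣m∣n⇒∣m+n (even zero) (∑-even (f ∘ suc) (even ∘ suc))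

countPairs≡∑∑ : ∀ {m} (a : Fin m → Fin m → Bool) →
                countPairs a ≡ ∑[ i < m ] ∑[ j < m ] ⟦ (toℕ i <ᵇ toℕ j) ∧ a i j ⟧
countPairs≡∑∑ {m} a =
  trans (∑-allFin λ i → List.sum (mapᴸ (indicator i) (allFin m)))
        (sum-cong-≗ {m} λ i → ∑-allFin (indicator i))
  where
  indicator : Fin m → Fin m → ℕ
  indicator i j = ⟦ (toℕ i <ᵇ toℕ j) ∧ a i j ⟧

countPairs-cong : ∀ {m} {a b : Fin m → Fin m → Bool} → (∀ i j → a i j ≡ b i j) →
                  countPairs a ≡ countPairs b
countPairs-cong {a = a} {b} a≗b =
  trans (countPairs≡∑∑ a)
        (trans (sum-cong-≗ λ i → sum-cong-≗ λ j → cong (λ x → ⟦ _ ∧ x ⟧) (a≗b i j))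
               (sym (countPairs≡∑∑ b)))

countPairs-empty : ∀ {m} {a : Fin m → Fin m → Bool} → (∀ i j → a i j ≡ false) → countPairs a ≡ 0
countPairs-empty {a = a} a≗false =
  trans (countPairs≡∑∑ a)
        (∑-zero λ i → ∑-zero λ j → cong ⟦_⟧ (trans (cong (_ ∧_) (a≗false i j)) (∧-zeroʳ _)))

countPairs-split : ∀ {m} (a s : Fin m → Fin m → Bool) →
  countPairs a ≡ countPairs (λ i j → a i j ∧ s i j) + countPairs (λ i j → a i j ∧ not (s i j))
countPairs-split a s = begin
  countPairs a
    ≡⟨ countPairs≡∑∑ a ⟩
  ∑[ i < _ ] ∑[ j < _ ] ⟦ (toℕ i <ᵇ toℕ j) ∧ a i j ⟧
    ≡⟨ sum-cong-≗ (λ i → trans (sum-cong-≗ λ j → split (toℕ i <ᵇ toℕ j) (a i j) (s i j))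
                               (∑-distrib-+ (with-s i) (without-s i))) ⟩
  ∑[ i < _ ] (∑[ j < _ ] with-s i j + ∑[ j < _ ] without-s i j)
    ≡⟨ ∑-distrib-+ (λ i → ∑[ j < _ ] with-s i j) (λ i → ∑[ j < _ ] without-s i j) ⟩
  ∑[ i < _ ] ∑[ j < _ ] with-s i j + ∑[ i < _ ] ∑[ j < _ ] without-s i j
    ≡⟨ sym (cong₂ _+_ (countPairs≡∑∑ λ i j → a i j ∧ s i j)
                                 (countPairs≡∑∑ λ i j → a i j ∧ not (s i j))) ⟩
  countPairs (λ i j → a i j ∧ s i j) + countPairs (λ i j → a i j ∧ not (s i j)) ∎
  where
  open ≡-Reasoning
  with-s without-s : Fin _ → Fin _ → ℕ
  with-s i j = ⟦ (toℕ i <ᵇ toℕ j) ∧ (a i j ∧ s i j) ⟧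
  without-s i j = ⟦ (toℕ i <ᵇ toℕ j) ∧ (a i j ∧ not (s i j)) ⟧
  split : ∀ c x y → ⟦ c ∧ x ⟧ ≡ ⟦ c ∧ (x ∧ y) ⟧ + ⟦ c ∧ (x ∧ not y) ⟧
  split false x y = refl
  split true false y = refl
  split true true false = refl
  split true true true = refl

countPairs-partition : ∀ {m k} (a : Fin m → Fin m → Bool) (P : Fin k → Fin m → Fin m → Bool) →
  (∀ i j → a i j ≡ true → ∑[ w < k ] ⟦ P w i j ⟧ ≡ 1) →
  countPairs a ≡ ∑[ w < k ] countPairs (λ i j → a i j ∧ P w i j)
countPairs-partition {m} {k} a P partition = begin
  countPairs a
    ≡⟨ countPairs≡∑∑ a ⟩
  ∑[ i < m ] ∑[ j < m ] ⟦ (toℕ i <ᵇ toℕ j) ∧ a i j ⟧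
    ≡⟨ sum-cong-≗ (λ i → sum-cong-≗ λ j → spread (toℕ i <ᵇ toℕ j) (a i j) (partition i j)) ⟩
  ∑[ i < m ] ∑[ j < m ] ∑[ w < k ] ⟦ (toℕ i <ᵇ toℕ j) ∧ (a i j ∧ P w i j) ⟧
    ≡⟨ sum-cong-≗ (λ i → ∑-comm λ j w → ⟦ (toℕ i <ᵇ toℕ j) ∧ (a i j ∧ P w i j) ⟧) ⟩
  ∑[ i < m ] ∑[ w < k ] ∑[ j < m ] ⟦ (toℕ i <ᵇ toℕ j) ∧ (a i j ∧ P w i j) ⟧
    ≡⟨ ∑-comm (λ i w → ∑[ j < m ] ⟦ (toℕ i <ᵇ toℕ j) ∧ (a i j ∧ P w i j) ⟧) ⟩
  ∑[ w < k ] ∑[ i < m ] ∑[ j < m ] ⟦ (toℕ i <ᵇ toℕ j) ∧ (a i j ∧ P w i j) ⟧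
    ≡⟨ sum-cong-≗ (λ w → sym (countPairs≡∑∑ λ i j → a i j ∧ P w i j)) ⟩
  ∑[ w < k ] countPairs (λ i j → a i j ∧ P w i j) ∎
  where
  open ≡-Reasoning
  spread : ∀ c x {p : Fin k → Bool} → (x ≡ true → ∑[ w < k ] ⟦ p w ⟧ ≡ 1) →
           ⟦ c ∧ x ⟧ ≡ ∑[ w < k ] ⟦ c ∧ (x ∧ p w) ⟧
  spread false x _ = sym (∑-zero {k} λ _ → refl)
  spread true false _ = sym (∑-zero {k} λ _ → refl)
  spread true true one = sym (one refl)

countPairs-unique : ∀ {m} (a : Fin m → Fin m → Bool) (i₀ j₀ : Fin m) → toℕ i₀ < toℕ j₀ →
  a i₀ j₀ ≡ true → (∀ i j → a i j ≡ true → (i ≡ i₀ × j ≡ j₀) ⊎ (i ≡ j₀ × j ≡ i₀)) →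
  countPairs a ≡ 1
countPairs-unique a i₀ j₀ i₀<j₀ a₀ unique =
  trans (countPairs≡∑∑ a) (∑∑-indicator-unique i₀ j₀ (cong₂ _∧_ ordered a₀) ordered-unique)
  where
  ordered : (toℕ i₀ <ᵇ toℕ j₀) ≡ true
  ordered = Equivalence.to T-≡ (<⇒<ᵇ i₀<j₀)
  ordered-unique : ∀ i j → ((toℕ i <ᵇ toℕ j) ∧ a i j) ≡ true → i ≡ i₀ × j ≡ j₀
  ordered-unique i j eq with ∧-true eq
  ... | i<j , aij with unique i j aij
  ...   | inj₁ same = same
  ...   | inj₂ (refl , refl) =
          contradiction i₀<j₀ (<-asym (<ᵇ⇒< _ _ (Equivalence.from T-≡ i<j)))

-- Walks and closed vertex sets

reach-snoc : ∀ {H : Graph} {x y z} → Reach H x y → adj H y z ≡ true → Reach H x z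
reach-snoc here e = step e here
reach-snoc (step e′ r) e = step e′ (reach-snoc r e)

reach-trans : ∀ {H : Graph} {x y z} → Reach H x y → Reach H y z → Reach H x z
reach-trans here r = r
reach-trans (step e r) r′ = step e (reach-trans r r′)

reach-sym : ∀ {H : Graph} {x y} → Reach H x y → Reach H y x
reach-sym here = here
reach-sym {H} (step {x} {y} e r) = reach-snoc (reach-sym r) (trans (Graph.sym H y x) e)

adj⇒≢ : ∀ {H : Graph} {a b} → adj H a b ≡ true → ¬ a ≡ b
adj⇒≢ {H} {a} ab refl = contradiction (trans (sym ab) (irrefl H a)) λ ()

Closed : (H : Graph) → (Fin (n H) → Bool) → Set
Closed H S = ∀ {a b} → adj H a b ≡ true → S a ≡ true → S b ≡ true

closed-reach : ∀ {H : Graph} {S x y} → Closed H S → S x ≡ true → Reach H x y → S y ≡ true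
closed-reach closed Sx here = Sx
closed-reach closed Sx (step e r) = closed-reach closed (closed e Sx) r

closed-edge : ∀ {H : Graph} {S a b} → Closed H S → adj H a b ≡ true → S a ≡ S b
closed-edge {H} {a = a} {b} closed e = ⇔→≡ (mk⇔ (closed e) (closed (trans (Graph.sym H b a) e)))

-- Reachability is decided by growing {x} one frontier vertex at a time; the number of
-- vertices outside the set bounds the number of steps.
module Saturation (H : Graph) (x : Fin (n H)) where

  ReachableSet : (Fin (n H) → Bool) → Set
  ReachableSet S = ∀ {z} → S z ≡ true → Reach H x z

  insert : Fin (n H) → (Fin (n H) → Bool) → Fin (n H) → Bool
  insert y S z = S z ∨ ⌊ z ≟ y ⌋

  outside : (Fin (n H) → Bool) → ℕ
  outside S = ∑[ z < n H ] ⟦ not (S z) ⟧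

  outside-insert : ∀ {S y} → S y ≡ false → outside S ≡ ℕ.suc (outside (insert y S))
  outside-insert {S} {y} Sy = begin
    outside S
      ≡⟨ sum-cong-≗ {n H} (λ z → count (S z) ⌊ z ≟ y ⌋ (S-false z)) ⟩
    ∑[ z < n H ] (⟦ not (insert y S z) ⟧ + ⟦ ⌊ z ≟ y ⌋ ⟧)
      ≡⟨ ∑-distrib-+ (λ z → ⟦ not (insert y S z) ⟧) (λ z → ⟦ ⌊ z ≟ y ⌋ ⟧) ⟩
    outside (insert y S) + ∑[ z < n H ] ⟦ ⌊ z ≟ y ⌋ ⟧
      ≡⟨ cong (outside (insert y S) +_)
              (∑-indicator-unique y (to⌊⌋ (y ≟ y) refl) (λ z → from⌊⌋ (z ≟ y))) ⟩
    outside (insert y S) + 1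
      ≡⟨ +-comm _ 1 ⟩
    ℕ.suc (outside (insert y S)) ∎
    where
    open ≡-Reasoning
    count : ∀ s d → (d ≡ true → s ≡ false) → ⟦ not s ⟧ ≡ ⟦ not (s ∨ d) ⟧ + ⟦ d ⟧
    count true true s-false = contradiction (s-false refl) λ ()
    count true false _ = refl
    count false true _ = refl
    count false false _ = refl
    S-false : ∀ z → ⌊ z ≟ y ⌋ ≡ true → S z ≡ false
    S-false z z≡y = subst (λ u → S u ≡ false) (sym (from⌊⌋ (z ≟ y) z≡y)) Sy

  reachable-insert : ∀ {S y z} → ReachableSet S → S z ≡ true → adj H z y ≡ true →
                     ReachableSet (insert y S)
  reachable-insert {S} {y} reach Sz e {u} u∈ with ∨-true u∈
  ... | inj₁ Su = reach Su
  ... | inj₂ u≡y = subst (Reach H x) (sym (from⌊⌋ (u ≟ y) u≡y)) (reach-snoc (reach Sz) e)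

  Frontier : (Fin (n H) → Bool) → Fin (n H) → Set
  Frontier S y = S y ≡ false × ∃ λ z → S z ≡ true × adj H z y ≡ true

  frontier? : ∀ S → Dec (∃ (Frontier S))
  frontier? S = any? λ y → (S y ≟ᵇ false) ×-dec any? λ z → (S z ≟ᵇ true) ×-dec (adj H z y ≟ᵇ true)

  closed-without-frontier : ∀ {S} → ¬ ∃ (Frontier S) → Closed H S
  closed-without-frontier {S} none {a} {b} e Sa with S b in Sb
  ... | true = refl
  ... | false = contradiction (b , Sb , a , Sa , e) none

  saturate : ∀ k S → outside S ≡ k → ReachableSet S →
             Σ (Fin (n H) → Bool) λ T →
               (∀ {z} → S z ≡ true → T z ≡ true) × Closed H T × ReachableSet T
  saturate k S out reach with frontier? S
  saturate k S out reach | no none = S , id , closed-without-frontier none , reach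
  saturate ℕ.zero S out reach | yes (y , Sy , _) =
    contradiction (trans (sym out) (outside-insert Sy)) λ ()
  saturate (ℕ.suc k) S out reach | yes (y , Sy , z , Sz , e) =
    let T , S∪y⊆T , closed , reachT =
          saturate k (insert y S) (suc-injective (trans (sym (outside-insert Sy)) out))
                   (reachable-insert reach Sz e)
    in T , (λ {u} Su → S∪y⊆T (cong (_∨ ⌊ u ≟ y ⌋) Su)) , closed , reachT

reach? : (H : Graph) → ∀ x y → Dec (Reach H x y)
reach? H x y =
  let T , x∈T , closed , reachT = saturate (outside singleton) singleton refl singleton-reachable
  in map′ reachT (closed-reach closed (x∈T (to⌊⌋ (x ≟ x) refl))) (T y ≟ᵇ true)
  where
  open Saturation H x
  singleton : Fin (n H) → Bool
  singleton z = ⌊ z ≟ x ⌋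
  singleton-reachable : ReachableSet singleton
  singleton-reachable {z} z≡x = subst (Reach H x) (sym (from⌊⌋ (z ≟ x) z≡x)) here

component : (H : Graph) → Fin (n H) → Fin (n H) → Bool
component H x y = ⌊ reach? H x y ⌋

component-sound : ∀ {H : Graph} {x y} → component H x y ≡ true → Reach H x y
component-sound {H} {x} {y} = from⌊⌋ (reach? H x y)

component-complete : ∀ {H : Graph} {x y} → Reach H x y → component H x y ≡ true
component-complete {H} {x} {y} = to⌊⌋ (reach? H x y)

component-closed : ∀ {H : Graph} {x} → Closed H (component H x)
component-closed e c = component-complete (reach-snoc (component-sound c) e)

-- Graphs whose vertices all reach one of two roots

sizeIn-cong : ∀ (H : Graph) {S T : Fin (n H) → Bool} → (∀ z → S z ≡ T z) → sizeIn H S ≡ sizeIn H T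
sizeIn-cong H S≗T = countPairs-cong λ i j → cong₂ (λ s t → adj H i j ∧ s ∧ t) (S≗T i) (S≗T j)

size-split-closed : ∀ {H : Graph} {S} → Closed H S → size H ≡ sizeIn H S + sizeIn H (not ∘ S)
size-split-closed {H} {S} closed =
  trans (countPairs-split (adj H) (λ i j → S i ∧ S j))
        (cong (sizeIn H S +_) (countPairs-cong outside))
  where
  outside : ∀ i j → adj H i j ∧ not (S i ∧ S j) ≡ adj H i j ∧ not (S i) ∧ not (S j)
  outside i j with adj H i j in e
  ... | false = refl
  ... | true = not-∧-equal (closed-edge {H} {S} {i} {j} closed e)

sizeIn-component-spanning : ∀ {H : Graph} {y} → (∀ z → Reach H y z) →
                            sizeIn H (component H y) ≡ size H
sizeIn-component-spanning {H} spans = countPairs-cong λ i j →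
  trans (cong₂ (λ s t → adj H i j ∧ s ∧ t) (component-complete (spans i))
                                             (component-complete (spans j)))
        (∧-identityʳ _)

allComponentsEven-twoRoots : ∀ {H : Graph} {x y} → (∀ z → Reach H z x ⊎ Reach H z y) →
  Even (size H) → Even (sizeIn H (component H y)) → AllComponentsEven H
allComponentsEven-twoRoots {H} {x} {y} roots even-H even-y x₀ S S⊆ ⊆S with reach? H x₀ y
... | yes x₀→y = subst Even (sym (sizeIn-cong H S≗y)) even-y
  where
  S≗y : ∀ z → S z ≡ component H y z
  S≗y z = ⇔→≡ (mk⇔ (λ Sz → component-complete (reach-trans (reach-sym x₀→y) (S⊆ z Sz)))
                   (λ yz → ⊆S z (reach-trans x₀→y (component-sound yz))))
... | no x₀↛y = subst Even (sym (sizeIn-cong H S≗rest)) even-rest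
  where
  even-rest : Even (sizeIn H (not ∘ component H y))
  even-rest =
    ∣m+n∣m⇒∣n (subst Even (size-split-closed {H} {component H y} component-closed) even-H) even-y
  x₀→x : Reach H x₀ x
  x₀→x = [ id , flip contradiction x₀↛y ]′ (roots x₀)
  S≗rest : ∀ z → S z ≡ not (component H y z)
  S≗rest z = ⇔→≡ (mk⇔
    (λ Sz → cong not (¬-not λ yz →
      x₀↛y (reach-trans (S⊆ z Sz) (reach-sym (component-sound yz)))))
    (λ ¬yz → ⊆S z ([ reach-trans x₀→x ∘ reach-sym
                   , (λ z→y → contradiction (component-complete (reach-sym z→y)) (not-true ¬yz))
                   ]′ (roots z))))

-- Deleting an edge

samePair-sound : ∀ {m} {p q u w : Fin m} → samePair p q u w ≡ true →
                 (p ≡ u × q ≡ w) ⊎ (p ≡ w × q ≡ u)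
samePair-sound {p = p} {q} {u} {w} same =
  map⊎ (both (p ≟ u) (q ≟ w)) (both (p ≟ w) (q ≟ u)) (∨-true same)
  where
  both : ∀ {A B : Set} (a? : Dec A) (b? : Dec B) → ⌊ a? ⌋ ∧ ⌊ b? ⌋ ≡ true → A × B
  both a? b? eq = let a , b = ∧-true eq in from⌊⌋ a? a , from⌊⌋ b? b

samePair-complete : ∀ {m} {p q u w : Fin m} → (p ≡ u × q ≡ w) ⊎ (p ≡ w × q ≡ u) →
                    samePair p q u w ≡ true
samePair-complete {p = p} {q} (inj₁ (refl , refl))
  rewrite to⌊⌋ (p ≟ p) refl | to⌊⌋ (q ≟ q) refl = refl
samePair-complete {p = p} {q} (inj₂ (refl , refl))
  rewrite to⌊⌋ (p ≟ p) refl | to⌊⌋ (q ≟ q) refl = ∨-zeroʳ _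

samePair-sym : ∀ {m} (p q u w : Fin m) → samePair p q u w ≡ samePair q p u w
samePair-sym p q u w =
  trans (∨-comm (⌊ p ≟ u ⌋ ∧ ⌊ q ≟ w ⌋) _)
        (cong₂ _∨_ (∧-comm ⌊ p ≟ w ⌋ ⌊ q ≟ u ⌋) (∧-comm ⌊ p ≟ u ⌋ ⌊ q ≟ w ⌋))

samePair-away : ∀ {m} {p q u w : Fin m} → ¬ p ≡ u → ¬ q ≡ u → samePair p q u w ≡ false
samePair-away p≢u q≢u = ¬-not λ same → [ p≢u ∘ proj₁ , q≢u ∘ proj₂ ]′ (samePair-sound same)

deleteEdge-⊆ : ∀ {G : Graph} {u w p q} → adj (deleteEdge G u w) p q ≡ true → adj G p q ≡ true
deleteEdge-⊆ = proj₁ ∘ ∧-true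

deleteEdge-keeps : ∀ {G : Graph} {u w p q} → adj G p q ≡ true → samePair p q u w ≡ false →
                   adj (deleteEdge G u w) p q ≡ true
deleteEdge-keeps pq other = cong₂ (λ a s → a ∧ not s) pq other

countPairs-samePair : ∀ {G : Graph} {u w} → adj G u w ≡ true →
                      countPairs (λ p q → adj G p q ∧ samePair p q u w) ≡ 1
countPairs-samePair {G} {u} {w} uw with <-cmp u w
... | tri< u<w _ _ =
  countPairs-unique edge u w u<w
    (cong₂ _∧_ uw (samePair-complete {p = u} {w} (inj₁ (refl , refl))))
    λ p q → samePair-sound {p = p} {q} {u} {w} ∘ proj₂ ∘ ∧-true
  where edge = λ p q → adj G p q ∧ samePair p q u w
... | tri≈ _ u≡w _ = contradiction u≡w (adj⇒≢ {G} uw)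
... | tri> _ _ w<u =
  countPairs-unique edge w u w<u
    (cong₂ _∧_ (trans (Graph.sym G w u) uw) (samePair-complete {p = w} {u} (inj₂ (refl , refl))))
    λ p q → swap⊎ ∘ samePair-sound {p = p} {q} {u} {w} ∘ proj₂ ∘ ∧-true
  where edge = λ p q → adj G p q ∧ samePair p q u w

size-deleteEdge : ∀ {G : Graph} {u w} → adj G u w ≡ true →
                  size G ≡ ℕ.suc (size (deleteEdge G u w))
size-deleteEdge {G} {u} {w} uw =
  trans (countPairs-split (adj G) (λ p q → samePair p q u w))
        (cong (_+ size (deleteEdge G u w)) (countPairs-samePair {G} uw))

even-size-deleteEdge : ∀ {G : Graph} {u w} → Odd (size G) → adj G u w ≡ true →
                       Even (size (deleteEdge G u w))
even-size-deleteEdge {G} {u} {w} odd uw =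
  odd-suc⇒even (subst Odd (size-deleteEdge {G} {u} {w} uw) odd)

countPairs-deleteEdge-∨ : ∀ {G : Graph} {u w} (R : Fin (n G) → Fin (n G) → Bool) →
  adj G u w ≡ true →
  countPairs (λ p q → adj G p q ∧ (samePair p q u w ∨ R p q)) ≡
  ℕ.suc (countPairs (λ p q → adj (deleteEdge G u w) p q ∧ R p q))
countPairs-deleteEdge-∨ {G} {u} {w} R uw = begin
  countPairs (λ p q → adj G p q ∧ (samePair p q u w ∨ R p q))
    ≡⟨ countPairs-split _ (λ p q → samePair p q u w) ⟩
  countPairs (λ p q → (adj G p q ∧ (samePair p q u w ∨ R p q)) ∧ samePair p q u w) +
  countPairs (λ p q → (adj G p q ∧ (samePair p q u w ∨ R p q)) ∧ not (samePair p q u w))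
    ≡⟨ cong₂ _+_ (countPairs-cong λ p q → on-edge (adj G p q) (samePair p q u w) (R p q))
                 (countPairs-cong λ p q → off-edge (adj G p q) (samePair p q u w) (R p q)) ⟩
  countPairs (λ p q → adj G p q ∧ samePair p q u w) +
  countPairs (λ p q → adj (deleteEdge G u w) p q ∧ R p q)
    ≡⟨ cong (_+ countPairs (λ p q → adj (deleteEdge G u w) p q ∧ R p q))
            (countPairs-samePair {G} uw) ⟩
  ℕ.suc (countPairs (λ p q → adj (deleteEdge G u w) p q ∧ R p q)) ∎
  where
  open ≡-Reasoning
  on-edge : ∀ a s r → (a ∧ (s ∨ r)) ∧ s ≡ a ∧ s
  on-edge false s r = refl
  on-edge true false r = ∧-zeroʳ r
  on-edge true true r = refl
  off-edge : ∀ a s r → (a ∧ (s ∨ r)) ∧ not s ≡ (a ∧ not s) ∧ r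
  off-edge false s r = refl
  off-edge true false r = ∧-identityʳ r
  off-edge true true r = refl

reach-endpoint-deleteEdge : ∀ {G : Graph} {u w z} → Reach G z u →
  Reach (deleteEdge G u w) z u ⊎ Reach (deleteEdge G u w) z w
reach-endpoint-deleteEdge here = inj₁ here
reach-endpoint-deleteEdge {G} {u} {w} {z} (step {y = b} zb r) with samePair z b u w in same
... | false = map⊎ (step kept) (step kept) (reach-endpoint-deleteEdge r)
  where
  kept : adj (deleteEdge G u w) z b ≡ true
  kept = deleteEdge-keeps {G} {u} {w} zb same
... | true with samePair-sound {p = z} {b} {u} {w} same
...   | inj₁ (refl , _) = inj₁ here
...   | inj₂ (refl , _) = inj₂ here

reach-deleteEdge-avoiding : ∀ {G : Graph} {u w w′ x y} → ¬ Reach (deleteEdge G u w) x u →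
  Reach (deleteEdge G u w) x y → Reach (deleteEdge G u w′) x y
reach-deleteEdge-avoiding {G} {u} {w} {w′} {x} x↛u = go here here
  where
  avoids : ∀ {a} → Reach (deleteEdge G u w) x a → ¬ a ≡ u
  avoids x→a refl = x↛u x→a
  go : ∀ {a b} → Reach (deleteEdge G u w) x a → Reach (deleteEdge G u w′) x a →
       Reach (deleteEdge G u w) a b → Reach (deleteEdge G u w′) x b
  go _ x→a here = x→a
  go x→a x→′a (step ac r) =
    go (reach-snoc x→a ac)
       (reach-snoc x→′a (deleteEdge-keeps {G} {u} {w′} (deleteEdge-⊆ {G} {u} {w} ac)
                           (samePair-away (avoids x→a) (avoids (reach-snoc x→a ac)))))
       r

module Branches (G : Graph) (v : Fin (n G)) where

  H : Fin (n G) → Graph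
  H w = deleteEdge G v w

  branch : Fin (n G) → Fin (n G) → Bool
  branch w = component (H w) w

  branchEdge : Fin (n G) → Fin (n G) → Fin (n G) → Bool
  branchEdge w i j = adj G v w ∧ (samePair i j v w ∨ (branch w i ∧ branch w j))

  Bridge : Fin (n G) → Set
  Bridge w = ¬ Reach (H w) w v

  bridge-if-odd-branch : ∀ {w} → Connected G → Odd (size G) → adj G v w ≡ true →
                         Odd (sizeIn (H w) (branch w)) → Bridge w
  bridge-if-odd-branch {w} conn odd vw odd-branch w→v =
    odd-branch (subst Even (sym (sizeIn-component-spanning spans))
                       (even-size-deleteEdge {G} {v} {w} odd vw))
    where
    spans : ∀ z → Reach (H w) w z
    spans z = [ reach-trans w→v ∘ reach-sym , reach-sym ]′ (reach-endpoint-deleteEdge (conn z v))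

  even-branchEdges : ∀ w → (adj G v w ≡ true → Odd (sizeIn (H w) (branch w))) →
                     Even (countPairs (λ i j → adj G i j ∧ branchEdge w i j))
  even-branchEdges w odd = by-cases (adj G v w ≟ᵇ true)
    where
    along : Fin (n G) → Fin (n G) → Bool
    along i j = samePair i j v w ∨ (branch w i ∧ branch w j)
    guarded : ∀ {b} → adj G v w ≡ b →
              ∀ i j → adj G i j ∧ branchEdge w i j ≡ adj G i j ∧ (b ∧ along i j)
    guarded vw i j = cong (λ b → adj G i j ∧ (b ∧ along i j)) vw
    by-cases : Dec (adj G v w ≡ true) → Even (countPairs (λ i j → adj G i j ∧ branchEdge w i j))
    by-cases (yes vw) =
      subst Even (sym (trans (countPairs-cong (guarded vw))
                             (countPairs-deleteEdge-∨ {G} {v} {w} _ vw)))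
            (odd⇒even-suc (odd vw))
    by-cases (no ¬vw) =
      subst Even (sym (trans (countPairs-cong (guarded (¬-not ¬vw)))
                             (countPairs-empty λ i j → ∧-zeroʳ (adj G i j))))
            (2 ∣0)

  branchEdge-sym : ∀ w i j → branchEdge w i j ≡ branchEdge w j i
  branchEdge-sym w i j =
    cong (adj G v w ∧_) (cong₂ _∨_ (samePair-sym i j v w) (∧-comm (branch w i) (branch w j)))

  branchEdge-away : ∀ {w i j} → adj G i j ≡ true → ¬ i ≡ v →
                    branchEdge w i j ≡ adj G v w ∧ branch w i
  branchEdge-away {w} {i} {j} ij i≢v =
    select (adj G v w) (samePair i j v w) (branch w i) (branch w j) i∈B j∈B
    where
    select : ∀ a s b c → (s ≡ true → b ≡ true) → (s ≡ false → b ≡ true → c ≡ true) →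
             a ∧ (s ∨ (b ∧ c)) ≡ a ∧ b
    select false _ _ _ _ _ = refl
    select true true _ _ b-true _ = sym (b-true refl)
    select true false false _ _ _ = refl
    select true false true _ _ c-true = c-true refl refl
    i∈B : samePair i j v w ≡ true → branch w i ≡ true
    i∈B same with samePair-sound {p = i} {j} {v} {w} same
    ... | inj₁ (i≡v , _) = contradiction i≡v i≢v
    ... | inj₂ (refl , _) = component-complete here
    j∈B : samePair i j v w ≡ false → branch w i ≡ true → branch w j ≡ true
    j∈B other = component-closed (deleteEdge-keeps {G} {v} {w} ij other)

  branch-cover : ∀ {a} → Reach G a v → ¬ a ≡ v →
                 ∃ λ w → adj G v w ≡ true × Reach (H w) w a
  branch-cover here a≢v = contradiction refl a≢v
  branch-cover {a} (step {y = b} ab b→v) a≢v with b ≟ v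
  ... | yes refl = a , trans (Graph.sym G v a) ab , here
  ... | no b≢v =
    let w , vw , w→b = branch-cover b→v b≢v
    in w , vw , reach-snoc w→b (deleteEdge-keeps {G} {v} {w} (trans (Graph.sym G b a) ab)
                                                 (samePair-away b≢v a≢v))

  branch-unique : ∀ {w w′ y} → Bridge w → Bridge w′ → adj G v w ≡ true →
                  Reach (H w) w y → Reach (H w′) w′ y → w ≡ w′
  branch-unique {w} {w′} bridge bridge′ vw w→y w′→y with w ≟ w′
  ... | yes w≡w′ = w≡w′
  ... | no w≢w′ = contradiction (reach-snoc w′→w wv) bridge′
    where
    w′→w : Reach (H w′) w′ w
    w′→w = reach-trans w′→y (reach-sym (reach-deleteEdge-avoiding bridge w→y))
    wv : adj (H w′) w v ≡ true
    wv = deleteEdge-keeps {G} {v} {w′} (trans (Graph.sym G w v) vw) (¬-not λ same →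
           [ (λ (w≡v , _) → bridge (subst (Reach (H w) w) w≡v here))
           , (λ (w≡w′ , _) → w≢w′ w≡w′) ]′ (samePair-sound same))

  module Bridged (conn : Connected G) (bridge : ∀ w → adj G v w ≡ true → Bridge w) where

    ∑-branch : ∀ {i} → ¬ i ≡ v → ∑[ w < n G ] ⟦ adj G v w ∧ branch w i ⟧ ≡ 1
    ∑-branch i≢v =
      let w₀ , vw₀ , w₀→i = branch-cover (conn _ v) i≢v
      in ∑-indicator-unique w₀ (cong₂ _∧_ vw₀ (component-complete w₀→i)) λ w w∋i →
           let vw , bi = ∧-true w∋i
           in branch-unique (bridge w vw) (bridge w₀ vw₀) vw (component-sound bi) w₀→i

    ∑-branchEdge-away : ∀ {i j} → adj G i j ≡ true → ¬ i ≡ v →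
                        ∑[ w < n G ] ⟦ branchEdge w i j ⟧ ≡ 1
    ∑-branchEdge-away ij i≢v =
      trans (sum-cong-≗ {n G} λ w → cong ⟦_⟧ (branchEdge-away ij i≢v)) (∑-branch i≢v)

    ∑-branchEdge : ∀ {i j} → adj G i j ≡ true → ∑[ w < n G ] ⟦ branchEdge w i j ⟧ ≡ 1
    ∑-branchEdge {i} {j} ij = by-cases (i ≟ v)
      where
      by-cases : Dec (i ≡ v) → ∑[ w < n G ] ⟦ branchEdge w i j ⟧ ≡ 1
      by-cases (no i≢v) = ∑-branchEdge-away ij i≢v
      by-cases (yes i≡v) = trans (sum-cong-≗ {n G} λ w → cong ⟦_⟧ (branchEdge-sym w i j))
                                 (∑-branchEdge-away (trans (Graph.sym G j i) ij) j≢v)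
        where
        j≢v : ¬ j ≡ v
        j≢v j≡v = adj⇒≢ {G} ij (trans i≡v (sym j≡v))

    size≡∑branchEdges : size G ≡ ∑[ w < n G ] countPairs (λ i j → adj G i j ∧ branchEdge w i j)
    size≡∑branchEdges = countPairs-partition (adj G) branchEdge λ i j → ∑-branchEdge

lemma5 : (G : Graph) → Connected G → Odd (size G) →
         (v : Fin (n G)) →
         Σ (Fin (n G)) (λ w → adj G v w ≡ true × AllComponentsEven (deleteEdge G v w))
lemma5 G conn odd v
  with any? (λ w → (adj G v w ≟ᵇ true) ×-dec
                   (2 ∣? sizeIn (deleteEdge G v w) (component (deleteEdge G v w) w)))
... | yes (w , vw , even-branch) =
  w , vw , allComponentsEven-twoRoots (reach-endpoint-deleteEdge ∘ flip conn v)
                                      (even-size-deleteEdge {G} {v} {w} odd vw) even-branch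
... | no no-even-branch = contradiction even odd
  where
  open Branches G v
  odd-branch : ∀ w → adj G v w ≡ true → Odd (sizeIn (H w) (branch w))
  odd-branch w vw even = no-even-branch (w , vw , even)
  even : Even (size G)
  even = subst Even (sym (Bridged.size≡∑branchEdges conn λ w vw →
                            bridge-if-odd-branch conn odd vw (odd-branch w vw)))
               (∑-even _ λ w → even-branchEdges w (odd-branch w))
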